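{- Let $T$ and $S$ be binary search trees on the same set of keys, with potential $\Phi = P(S) - P(T)$ as defined in the context. Splaying a node $v$ in $S$ (while $T$ is unchanged) takes amortized time at most $4 + 6\, d_T(v)$, where $d_T(v)$ is the depth in $T$ of the node with the same key as $v$.
   Context: Nodes of $T$ and $S$ are identified via the key they store. $d_T(v)$ is the depth of $v$ in $T$ (root depth $0$); $w_T(v) = 1/4^{d_T(v)}$; the weight of a node $v$ of $S$ is $w(v) = w_T(v)$. $s_T(v)$, $s(v)$ are the sums of weights over the subtree of $v$ in $T$, resp. in $S$ (including $v$); $r_T(v) = \log_2 s_T(v)$, $r(v) = \log_2 s(v)$; $P(T) = \sum_{v\in T} r_T(v)$, $P(S) = \sum_{v \in S} r(v)$, $\Phi = P(S) - P(T)$. Splaying $v$ in $S$ moves $v$ to the root by repeated splay steps: if the parent $y$ of $v$ is the root, a single rotation of $v$ (Zig); if $v$ and its parent $y$ are both left children or both right children, rotate $y$ over its parent and then $v$ over $y$ (ZigZig); otherwise rotate $v$ twice (ZigZag). The actual cost of a splay is $1$ per Zig and $2$ per ZigZig or ZigZag (i.e., the number of cursor moves, the depth of $v$ in $S$). The amortized time of an operation is its actual cost plus the resulting change in $\Phi$. -}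

module Defs where

open import Data.Nat as ℕ using (ℕ; zero; suc; _+_; _^_; _<ᵇ_; _≡ᵇ_)
open import Data.Nat.Properties using (m^n≢0)
open import Data.Integer using (+_)
open import Data.Rational as ℚ using (ℚ; 0ℚ; 1ℚ)
open import Data.Bool using (Bool; true; false; if_then_else_)
open import Data.Maybe using (Maybe; just; nothing; _<∣>_)
import Data.Maybe as Maybe
open import Data.Product using (_×_; _,_)
open import Data.List using (List; []; _∷_; _++_)
open import Data.List.Relation.Unary.Linked using (Linked)
open import Data.List.Membership.Propositional using (_∈_)
open import Function.Bundles using (_⇔_)

data Tree : Set where
  leaf : Tree
  node : Tree → ℕ → Tree → Tree

inorder : Tree → List ℕ
inorder leaf = []
inorder (node l k r) = inorder l ++ (k ∷ inorder r)

IsBST : Tree → Set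
IsBST t = Linked ℕ._<_ (inorder t)

SameKeys : Tree → Tree → Set
SameKeys S T = ∀ k → (k ∈ inorder S) ⇔ (k ∈ inorder T)

depth : ℕ → Tree → Maybe ℕ
depth k leaf = nothing
depth k (node l x r) =
  if k ≡ᵇ x then just 0
  else (Maybe.map suc (depth k l) <∣> Maybe.map suc (depth k r))

-- w_T(k) = 1 / 4^{d_T(k)}  (0 if k not in T; never used under SameKeys)
wT : Tree → ℕ → ℚ
wT T k with depth k T
... | just d = (+ 1) ℚ./ (4 ^ d) where instance _ = m^n≢0 4 d
... | nothing = 0ℚ

s : Tree → Tree → ℚ
s T leaf = 0ℚ
s T (node l k r) = s T l ℚ.+ wT T k ℚ.+ s T r

-- 2^{P(X)} = product over nodes v of X of s(v), where P(X) = Σ_v log₂ s(v).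
-- (Applied with X = T this is 2^{P(T)}, since s T restricted to T is s_T.)
expP : Tree → Tree → ℚ
expP T leaf = 1ℚ
expP T t@(node l k r) = expP T l ℚ.* s T t ℚ.* expP T r

data Ctx : Set where
  top : Ctx
  -- focus is the left child of a node with key x and right subtree c
  inL : Ctx → ℕ → Tree → Ctx
  -- focus is the right child of a node with left subtree c and key x
  inR : Ctx → Tree → ℕ → Ctx

locate : ℕ → Ctx → Tree → Maybe (Ctx × Tree × ℕ × Tree)
locate k c leaf = nothing
locate k c (node l x r) =
  if k ≡ᵇ x then just (c , l , x , r)
  else (if k <ᵇ x then locate k (inL c x r) l else locate k (inR c l x) r)

splayUp : Ctx → Tree → ℕ → Tree → Tree × ℕ
splayUp top a v b = node a v b , 0
splayUp (inL top x c) a v b = node a v (node b x c) , 1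
splayUp (inR top c x) a v b = node (node c x a) v b , 1
splayUp (inL (inL g y d) x c) a v b with splayUp g a v (node b x (node c y d))
... | (t , n) = t , 2 + n
splayUp (inR (inR g d y) c x) a v b with splayUp g (node (node d y c) x a) v b
... | (t , n) = t , 2 + n
splayUp (inL (inR g d y) x c) a v b with splayUp g (node d y a) v (node b x c)
... | (t , n) = t , 2 + n
splayUp (inR (inL g y d) c x) a v b with splayUp g (node c x a) v (node b y d)
... | (t , n) = t , 2 + n

splay : ℕ → Tree → Maybe (Tree × ℕ)
splay k S with locate k top S
... | just (c , a , v , b) = just (splayUp c a v b)
... | nothing = nothing

pow2 : ℕ → ℚ
pow2 n = (+ (2 ^ n)) ℚ./ 1

-- T is unchanged, so splaying changes Φ by P(S′) − P(S), and 2^P(S) = expP T S is the product of the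
-- subtree weights of S; the claim thus reads 2^cost · expP T S′ ≤ 2^(4 + 6d) · expP T S.  The access
-- lemma of Sleator and Tarjan bounds the amortized cost by 1 + 3 (r(root) − r(v)): a zig costs at
-- most 1 + 3 Δr(v), a zig-zig or zig-zag at most 3 Δr(v) because 4ab ≤ (a + b)² for the weights a, b
-- of two disjoint subtrees, and these bounds telescope.  Finally r(v) ≥ log₂ w(v) = −2d, and
-- r(root) ≤ 1 because the weights of distinct keys sum to at most 2 (by induction on T, as
-- 1 + ¼ · 2 + ¼ · 2 = 2); so the amortized cost is at most 1 + 3 (1 + 2d) = 4 + 6d.
module Submission where

open import Defs
open import Data.Nat using (ℕ; _+_; _*_; zero; suc; _^_; _≡ᵇ_; _<ᵇ_; NonZero)
open import Data.Rational using (_≤_; ℚ; 0ℚ; 1ℚ; _<_; toℚᵘ)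
import Data.Rational as ℚ
open import Data.Maybe using (just; Maybe; nothing; _<∣>_)
open import Data.Product using (_,_; _×_; proj₁; proj₂; ∃-syntax)
open import Relation.Binary.PropositionalEquality using (_≡_; _≢_; refl; sym; trans; cong; cong₂; subst; subst₂)

import Data.Nat.Properties as ℕ
import Data.Nat.Tactic.RingSolver as ℕ-Solver
open import Data.Integer using (+_)
import Data.Integer.Properties as ℤ
import Data.Rational.Properties as ℚ
import Data.Rational.Unnormalised as ℚᵘ
import Data.Rational.Unnormalised.Properties as ℚᵘ
import Data.Maybe as Maybe
open import Data.Maybe.Properties using (just-injective)
open import Data.Bool using (true; false; if_then_else_)
import Data.Bool as Bool
open import Data.Sum using (inj₁; inj₂)
open import Data.List using (List; []; _∷_; _++_)
open import Data.List.Relation.Unary.All using (All; []; _∷_)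
open import Data.List.Relation.Unary.AllPairs as AllPairs using ([]; _∷_)
open import Data.List.Relation.Unary.Unique.Propositional using (Unique)
open import Data.List.Relation.Unary.Linked.Properties using (Linked⇒AllPairs)
open import Relation.Nullary using (contradiction)
open import Level using (0ℓ)
open import Tactic.RingSolver.Core.AlmostCommutativeRing using (AlmostCommutativeRing; fromCommutativeRing)
open import Tactic.RingSolver using (solve-∀)

ℚ-ring : AlmostCommutativeRing 0ℓ 0ℓ
ℚ-ring = fromCommutativeRing ℚ.+-*-commutativeRing (λ _ → nothing)

2ℚ 4ℚ ¼ : ℚ
2ℚ = + 2 ℚ./ 1
4ℚ = + 4 ℚ./ 1
¼  = + 1 ℚ./ 4

¼^ : ℕ → ℚ
¼^ d = + 1 ℚ./ (4 ^ d)
  where instance _ = ℕ.m^n≢0 4 d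

cube : ℚ → ℚ
cube p = p ℚ.* p ℚ.* p

/-homo-* : ∀ a b m n .{{_ : NonZero m}} .{{_ : NonZero n}} .{{_ : NonZero (m * n)}} →
           + (a * b) ℚ./ (m * n) ≡ (+ a ℚ./ m) ℚ.* (+ b ℚ./ n)
/-homo-* a b m@(suc _) n@(suc _) = ℚ.toℚᵘ-injective (begin-equality
  toℚᵘ (+ (a * b) ℚ./ (m * n))
    ≃⟨ toℚᵘ-/ (+ (a * b)) (m * n) ⟩
  + (a * b) ℚᵘ./ (m * n)
    ≡⟨ cong (ℚᵘ._/ (m * n)) (ℤ.pos-* a b) ⟩
  (+ a ℚᵘ./ m) ℚᵘ.* (+ b ℚᵘ./ n)
    ≃⟨ ℚᵘ.*-cong (ℚᵘ.≃-sym (toℚᵘ-/ (+ a) m)) (ℚᵘ.≃-sym (toℚᵘ-/ (+ b) n)) ⟩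
  toℚᵘ (+ a ℚ./ m) ℚᵘ.* toℚᵘ (+ b ℚ./ n)
    ≃⟨ ℚᵘ.≃-sym (ℚ.toℚᵘ-homo-* (+ a ℚ./ m) (+ b ℚ./ n)) ⟩
  toℚᵘ ((+ a ℚ./ m) ℚ.* (+ b ℚ./ n)) ∎)
  where
  open ℚᵘ.≤-Reasoning
  toℚᵘ-/ : ∀ i k .{{_ : NonZero k}} → toℚᵘ (i ℚ./ k) ℚᵘ.≃ (i ℚᵘ./ k)
  toℚᵘ-/ i (suc k) = ℚ.toℚᵘ-fromℚᵘ (ℚᵘ.mkℚᵘ i k)

open ℚ.≤-Reasoning

*-nonNeg : ∀ {p q} → 0ℚ ≤ p → 0ℚ ≤ q → 0ℚ ≤ p ℚ.* q
*-nonNeg {p} {q} 0≤p 0≤q =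
  ℚ.nonNegative⁻¹ _ {{ℚ.nonNeg*nonNeg⇒nonNeg p {{ℚ.nonNegative 0≤p}} q {{ℚ.nonNegative 0≤q}}}}

+-nonNeg : ∀ {p q} → 0ℚ ≤ p → 0ℚ ≤ q → 0ℚ ≤ p ℚ.+ q
+-nonNeg = ℚ.+-mono-≤

*-monoˡ-≤ : ∀ {p q} r → 0ℚ ≤ r → p ≤ q → r ℚ.* p ≤ r ℚ.* q
*-monoˡ-≤ r 0≤r = ℚ.*-monoˡ-≤-nonNeg r {{ℚ.nonNegative 0≤r}}

*-monoʳ-≤ : ∀ {p q} r → 0ℚ ≤ r → p ≤ q → p ℚ.* r ≤ q ℚ.* r
*-monoʳ-≤ r 0≤r = ℚ.*-monoʳ-≤-nonNeg r {{ℚ.nonNegative 0≤r}}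

*-mono-≤ : ∀ {p q r t} → 0ℚ ≤ p → 0ℚ ≤ r → p ≤ q → r ≤ t → p ℚ.* r ≤ q ℚ.* t
*-mono-≤ {p} {q} {r} {t} 0≤p 0≤r p≤q r≤t = begin
  p ℚ.* r  ≤⟨ *-monoʳ-≤ r 0≤r p≤q ⟩
  q ℚ.* r  ≤⟨ *-monoˡ-≤ q (ℚ.≤-trans 0≤p p≤q) r≤t ⟩
  q ℚ.* t  ∎

p≤p+q : ∀ p {q} → 0ℚ ≤ q → p ≤ p ℚ.+ q
p≤p+q p {q} 0≤q = begin
  p          ≡⟨ sym (ℚ.+-identityʳ p) ⟩
  p ℚ.+ 0ℚ   ≤⟨ ℚ.+-monoʳ-≤ p 0≤q ⟩
  p ℚ.+ q    ∎

q≤p+q : ∀ {p} q → 0ℚ ≤ p → q ≤ p ℚ.+ q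
q≤p+q {p} q 0≤p = subst (q ≤_) (ℚ.+-comm q p) (p≤p+q q 0≤p)

0≤1 : 0ℚ ≤ 1ℚ
0≤1 = ℚ.nonNegative⁻¹ 1ℚ

1≤2 : 1ℚ ≤ 2ℚ
1≤2 = p≤p+q 1ℚ 0≤1

cube-nonNeg : ∀ {p} → 0ℚ ≤ p → 0ℚ ≤ cube p
cube-nonNeg 0≤p = *-nonNeg (*-nonNeg 0≤p 0≤p) 0≤p

cube-pos : ∀ {p} → 0ℚ < p → 0ℚ < cube p
cube-pos {p} 0<p = ℚ.positive⁻¹ (cube p) {{ℚ.pos*pos⇒pos (p ℚ.* p) {{p²-pos}} p {{p-pos}}}}
  where
  p-pos : ℚ.Positive p
  p-pos = ℚ.positive 0<p
  p²-pos : ℚ.Positive (p ℚ.* p)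
  p²-pos = ℚ.pos*pos⇒pos p {{p-pos}} p {{p-pos}}

cube-mono-≤ : ∀ {p q} → 0ℚ ≤ p → p ≤ q → cube p ≤ cube q
cube-mono-≤ 0≤p p≤q = *-mono-≤ (*-nonNeg 0≤p 0≤p) 0≤p (*-mono-≤ 0≤p 0≤p p≤q p≤q) p≤q

square-nonNeg : ∀ p → 0ℚ ≤ p ℚ.* p
square-nonNeg p with ℚ.≤-total 0ℚ p
... | inj₁ 0≤p = *-nonNeg 0≤p 0≤p
... | inj₂ p≤0 = subst (0ℚ ≤_) (neg*neg p) (*-nonNeg (ℚ.neg-antimono-≤ p≤0) (ℚ.neg-antimono-≤ p≤0))
  where
  neg*neg : ∀ p → (ℚ.- p) ℚ.* (ℚ.- p) ≡ p ℚ.* p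
  neg*neg = solve-∀ ℚ-ring

4pq≤R² : ∀ {p q R} → 0ℚ ≤ p → 0ℚ ≤ q → p ℚ.+ q ≤ R → 4ℚ ℚ.* (p ℚ.* q) ≤ R ℚ.* R
4pq≤R² {p} {q} {R} 0≤p 0≤q p+q≤R = begin
  4ℚ ℚ.* (p ℚ.* q)                                ≤⟨ p≤p+q _ (square-nonNeg (p ℚ.- q)) ⟩
  4ℚ ℚ.* (p ℚ.* q) ℚ.+ (p ℚ.- q) ℚ.* (p ℚ.- q)   ≡⟨ square-of-sum p q ⟩
  (p ℚ.+ q) ℚ.* (p ℚ.+ q)                         ≤⟨ *-mono-≤ 0≤p+q 0≤p+q p+q≤R p+q≤R ⟩
  R ℚ.* R                                         ∎
  where
  0≤p+q : 0ℚ ≤ p ℚ.+ q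
  0≤p+q = +-nonNeg 0≤p 0≤q
  square-of-sum : ∀ p q → 4ℚ ℚ.* (p ℚ.* q) ℚ.+ (p ℚ.- q) ℚ.* (p ℚ.- q) ≡ (p ℚ.+ q) ℚ.* (p ℚ.+ q)
  square-of-sum = solve-∀ ℚ-ring

-- In a zig-zig or zig-zag step a and b are the weights of two disjoint subtrees of the rotated part,
-- so a + b ≤ R; AM–GM on them pays for the two rotations.
double-rotation-bound : ∀ {σ p u R a b} → 0ℚ ≤ σ → 0ℚ ≤ u → 0ℚ ≤ a → 0ℚ ≤ b →
                        σ ≤ p → u ≤ R → a ℚ.+ b ≤ R →
                        σ ℚ.* u ℚ.* (4ℚ ℚ.* (a ℚ.* b)) ≤ p ℚ.* R ℚ.* (R ℚ.* R)
double-rotation-bound 0≤σ 0≤u 0≤a 0≤b σ≤p u≤R a+b≤R =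
  *-mono-≤ (*-nonNeg 0≤σ 0≤u) (*-nonNeg (ℚ.nonNegative⁻¹ 4ℚ) (*-nonNeg 0≤a 0≤b))
    (*-mono-≤ 0≤σ 0≤u σ≤p u≤R) (4pq≤R² 0≤a 0≤b a+b≤R)

pow2-+ : ∀ m n → pow2 (m + n) ≡ pow2 m ℚ.* pow2 n
pow2-+ m n = trans (cong (λ k → + k ℚ./ 1) (ℕ.^-distribˡ-+-* 2 m n)) (/-homo-* (2 ^ m) (2 ^ n) 1 1)

pow2-nonNeg : ∀ n → 0ℚ ≤ pow2 n
pow2-nonNeg n = ℚ.nonNegative⁻¹ _ {{ℚ.normalize-nonNeg (2 ^ n) 1}}

pow2-4+6* : ∀ d → pow2 (4 + 6 * d) ≡ pow2 4 ℚ.* cube (pow2 (d + d))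
pow2-4+6* d = begin-equality
  pow2 (4 + 6 * d)              ≡⟨ cong pow2 (6d≡2d+2d+2d d) ⟩
  pow2 (4 + (e + e + e))        ≡⟨ pow2-+ 4 (e + e + e) ⟩
  pow2 4 ℚ.* pow2 (e + e + e)   ≡⟨ cong (pow2 4 ℚ.*_) (trans (pow2-+ (e + e) e)
                                                              (cong (ℚ._* pow2 e) (pow2-+ e e))) ⟩
  pow2 4 ℚ.* cube (pow2 e)      ∎
  where
  e : ℕ
  e = d + d
  6d≡2d+2d+2d : ∀ d → 4 + 6 * d ≡ 4 + ((d + d) + (d + d) + (d + d))
  6d≡2d+2d+2d = ℕ-Solver.solve-∀

¼^-suc : ∀ d → ¼^ (suc d) ≡ ¼ ℚ.* ¼^ d
¼^-suc d = /-homo-* 1 1 4 (4 ^ d) {{_}} {{ℕ.m^n≢0 4 d}} {{ℕ.m^n≢0 4 (suc d)}}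

¼^-pos : ∀ d → 0ℚ < ¼^ d
¼^-pos d = ℚ.positive⁻¹ _ {{ℚ.normalize-pos 1 (4 ^ d) {{ℕ.m^n≢0 4 d}}}}

¼^-inverse : ∀ d → ¼^ d ℚ.* pow2 (d + d) ≡ 1ℚ
¼^-inverse d = trans (cong (¼^ d ℚ.*_) (pow2-+ d d)) (inverse d)
  where
  regroup : ∀ a w b p → a ℚ.* w ℚ.* (b ℚ.* p ℚ.* (b ℚ.* p)) ≡ a ℚ.* b ℚ.* b ℚ.* (w ℚ.* (p ℚ.* p))
  regroup = solve-∀ ℚ-ring

  inverse : ∀ d → ¼^ d ℚ.* (pow2 d ℚ.* pow2 d) ≡ 1ℚ
  inverse zero    = refl
  inverse (suc d) = begin-equality
    ¼^ (suc d) ℚ.* (pow2 (suc d) ℚ.* pow2 (suc d))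
      ≡⟨ cong₂ (λ w p → w ℚ.* (p ℚ.* p)) (¼^-suc d) (pow2-+ 1 d) ⟩
    ¼ ℚ.* ¼^ d ℚ.* (2ℚ ℚ.* pow2 d ℚ.* (2ℚ ℚ.* pow2 d))
      ≡⟨ regroup ¼ (¼^ d) 2ℚ (pow2 d) ⟩
    ¼ ℚ.* 2ℚ ℚ.* 2ℚ ℚ.* (¼^ d ℚ.* (pow2 d ℚ.* pow2 d))
      ≡⟨ cong (¼ ℚ.* 2ℚ ℚ.* 2ℚ ℚ.*_) (inverse d) ⟩
    1ℚ ∎

depthWeight : Maybe ℕ → ℚ
depthWeight (just d) = ¼^ d
depthWeight nothing  = 0ℚ

wT≡depthWeight : ∀ T k → wT T k ≡ depthWeight (depth k T)
wT≡depthWeight T k with depth k T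
... | just d  = refl
... | nothing = refl

depthWeight-nonNeg : ∀ m → 0ℚ ≤ depthWeight m
depthWeight-nonNeg (just d) = ℚ.<⇒≤ (¼^-pos d)
depthWeight-nonNeg nothing  = ℚ.≤-refl

depthWeight-<∣> : ∀ m₁ m₂ → depthWeight (m₁ <∣> m₂) ≤ depthWeight m₁ ℚ.+ depthWeight m₂
depthWeight-<∣> (just d) m₂ = p≤p+q (¼^ d) (depthWeight-nonNeg m₂)
depthWeight-<∣> nothing  m₂ = ℚ.≤-reflexive (sym (ℚ.+-identityˡ _))

depthWeight-suc : ∀ m → depthWeight (Maybe.map suc m) ≡ ¼ ℚ.* depthWeight m
depthWeight-suc (just d) = ¼^-suc d
depthWeight-suc nothing  = refl

indicator : ℕ → ℕ → ℚ
indicator x k = if k ≡ᵇ x then 1ℚ else 0ℚ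

depthWeight-node : ∀ l x r k → depthWeight (depth k (node l x r))
                               ≤ indicator x k ℚ.+ ¼ ℚ.* (depthWeight (depth k l) ℚ.+ depthWeight (depth k r))
depthWeight-node l x r k with k ≡ᵇ x
... | true  =
  p≤p+q 1ℚ (*-nonNeg (ℚ.nonNegative⁻¹ ¼)
                      (+-nonNeg (depthWeight-nonNeg (depth k l)) (depthWeight-nonNeg (depth k r))))
... | false = begin
  depthWeight (Maybe.map suc dₗ <∣> Maybe.map suc dᵣ)
    ≤⟨ depthWeight-<∣> (Maybe.map suc dₗ) _ ⟩
  depthWeight (Maybe.map suc dₗ) ℚ.+ depthWeight (Maybe.map suc dᵣ)
    ≡⟨ cong₂ ℚ._+_ (depthWeight-suc dₗ) (depthWeight-suc dᵣ) ⟩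
  ¼ ℚ.* depthWeight dₗ ℚ.+ ¼ ℚ.* depthWeight dᵣ
    ≡⟨ sym (ℚ.*-distribˡ-+ ¼ (depthWeight dₗ) (depthWeight dᵣ)) ⟩
  ¼ ℚ.* (depthWeight dₗ ℚ.+ depthWeight dᵣ)
    ≡⟨ sym (ℚ.+-identityˡ _) ⟩
  0ℚ ℚ.+ ¼ ℚ.* (depthWeight dₗ ℚ.+ depthWeight dᵣ) ∎
  where
  dₗ dᵣ : Maybe ℕ
  dₗ = depth k l
  dᵣ = depth k r

≡ᵇ-true⇒≡ : ∀ {m n} → (m ≡ᵇ n) ≡ true → m ≡ n
≡ᵇ-true⇒≡ {m} {n} eq = ℕ.≡ᵇ⇒≡ m n (subst Bool.T (sym eq) _)

sumOver : (ℕ → ℚ) → List ℕ → ℚ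
sumOver f []       = 0ℚ
sumOver f (k ∷ ks) = f k ℚ.+ sumOver f ks

sumOver-mono : ∀ {f g} → (∀ k → f k ≤ g k) → ∀ ks → sumOver f ks ≤ sumOver g ks
sumOver-mono f≤g []       = ℚ.≤-refl
sumOver-mono f≤g (k ∷ ks) = ℚ.+-mono-≤ (f≤g k) (sumOver-mono f≤g ks)

sumOver-+ : ∀ f g ks → sumOver (λ k → f k ℚ.+ g k) ks ≡ sumOver f ks ℚ.+ sumOver g ks
sumOver-+ f g []       = refl
sumOver-+ f g (k ∷ ks) = trans (cong (f k ℚ.+ g k ℚ.+_) (sumOver-+ f g ks)) (interchange (f k) (g k) _ _)
  where
  interchange : ∀ a b c d → a ℚ.+ b ℚ.+ (c ℚ.+ d) ≡ a ℚ.+ c ℚ.+ (b ℚ.+ d)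
  interchange = solve-∀ ℚ-ring

sumOver-* : ∀ p f ks → sumOver (λ k → p ℚ.* f k) ks ≡ p ℚ.* sumOver f ks
sumOver-* p f []       = sym (ℚ.*-zeroʳ p)
sumOver-* p f (k ∷ ks) = trans (cong (p ℚ.* f k ℚ.+_) (sumOver-* p f ks)) (sym (ℚ.*-distribˡ-+ p (f k) _))

sumOver-++ : ∀ f ks ls → sumOver f (ks ++ ls) ≡ sumOver f ks ℚ.+ sumOver f ls
sumOver-++ f []       ls = sym (ℚ.+-identityˡ _)
sumOver-++ f (k ∷ ks) ls = trans (cong (f k ℚ.+_) (sumOver-++ f ks ls)) (sym (ℚ.+-assoc (f k) _ _))

sumOver-indicator-∉ : ∀ {x ks} → All (x ≢_) ks → sumOver (indicator x) ks ≡ 0ℚ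
sumOver-indicator-∉ []                        = refl
sumOver-indicator-∉ {x} {k ∷ _} (x≢k ∷ x∉ks) with k ≡ᵇ x in k≡ᵇx
... | true  = contradiction (sym (≡ᵇ-true⇒≡ k≡ᵇx)) x≢k
... | false = trans (ℚ.+-identityˡ _) (sumOver-indicator-∉ x∉ks)

sumOver-indicator≤1 : ∀ x {ks} → Unique ks → sumOver (indicator x) ks ≤ 1ℚ
sumOver-indicator≤1 x []                       = 0≤1
sumOver-indicator≤1 x {k ∷ ks} (k∉ks ∷ unique) with k ≡ᵇ x in k≡ᵇx
... | true  = begin
  1ℚ ℚ.+ sumOver (indicator x) ks
    ≡⟨ cong (1ℚ ℚ.+_) (sumOver-indicator-∉ (subst (λ z → All (z ≢_) ks) (≡ᵇ-true⇒≡ k≡ᵇx) k∉ks)) ⟩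
  1ℚ ℚ.+ 0ℚ
    ≡⟨ ℚ.+-identityʳ 1ℚ ⟩
  1ℚ ∎
... | false = ℚ.≤-trans (ℚ.≤-reflexive (ℚ.+-identityˡ _)) (sumOver-indicator≤1 x unique)

sumOver-depthWeight≤2 : ∀ t {ks} → Unique ks → sumOver (λ k → depthWeight (depth k t)) ks ≤ 2ℚ
sumOver-depthWeight≤2 leaf         {[]}     _            = ℚ.nonNegative⁻¹ 2ℚ
sumOver-depthWeight≤2 leaf         {_ ∷ _}  (_ ∷ unique) =
  ℚ.≤-trans (ℚ.≤-reflexive (ℚ.+-identityˡ _)) (sumOver-depthWeight≤2 leaf unique)
sumOver-depthWeight≤2 (node l x r) {ks}     unique       = begin
  sumOver (λ k → depthWeight (depth k (node l x r))) ks
    ≤⟨ sumOver-mono (depthWeight-node l x r) ks ⟩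
  sumOver (λ k → indicator x k ℚ.+ ¼ ℚ.* (wₗ k ℚ.+ wᵣ k)) ks
    ≡⟨ sumOver-+ (indicator x) _ ks ⟩
  sumOver (indicator x) ks ℚ.+ sumOver (λ k → ¼ ℚ.* (wₗ k ℚ.+ wᵣ k)) ks
    ≡⟨ cong (sumOver (indicator x) ks ℚ.+_)
            (trans (sumOver-* ¼ _ ks) (cong (¼ ℚ.*_) (sumOver-+ wₗ wᵣ ks))) ⟩
  sumOver (indicator x) ks ℚ.+ ¼ ℚ.* (sumOver wₗ ks ℚ.+ sumOver wᵣ ks)
    ≤⟨ ℚ.+-mono-≤ (sumOver-indicator≤1 x unique)
                   (*-monoˡ-≤ ¼ (ℚ.nonNegative⁻¹ ¼)
                     (ℚ.+-mono-≤ (sumOver-depthWeight≤2 l unique) (sumOver-depthWeight≤2 r unique))) ⟩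
  1ℚ ℚ.+ ¼ ℚ.* (2ℚ ℚ.+ 2ℚ)
    ≡⟨⟩
  2ℚ ∎
  where
  wₗ wᵣ : ℕ → ℚ
  wₗ k = depthWeight (depth k l)
  wᵣ k = depthWeight (depth k r)

s≡sumOver-inorder : ∀ T t → s T t ≡ sumOver (wT T) (inorder t)
s≡sumOver-inorder T leaf         = refl
s≡sumOver-inorder T (node l k r) = begin-equality
  s T l ℚ.+ wT T k ℚ.+ s T r
    ≡⟨ cong₂ (λ σₗ σᵣ → σₗ ℚ.+ wT T k ℚ.+ σᵣ) (s≡sumOver-inorder T l) (s≡sumOver-inorder T r) ⟩
  sumOver (wT T) (inorder l) ℚ.+ wT T k ℚ.+ sumOver (wT T) (inorder r)
    ≡⟨ ℚ.+-assoc (sumOver (wT T) (inorder l)) _ _ ⟩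
  sumOver (wT T) (inorder l) ℚ.+ sumOver (wT T) (k ∷ inorder r)
    ≡⟨ sym (sumOver-++ (wT T) (inorder l) (k ∷ inorder r)) ⟩
  sumOver (wT T) (inorder (node l k r)) ∎

s≤2 : ∀ T S → IsBST S → s T S ≤ 2ℚ
s≤2 T S increasing = begin
  s T S
    ≡⟨ s≡sumOver-inorder T S ⟩
  sumOver (wT T) (inorder S)
    ≤⟨ sumOver-mono (λ k → ℚ.≤-reflexive (wT≡depthWeight T k)) (inorder S) ⟩
  sumOver (λ k → depthWeight (depth k T)) (inorder S)
    ≤⟨ sumOver-depthWeight≤2 T unique ⟩
  2ℚ ∎
  where
  unique : Unique (inorder S)
  unique = AllPairs.map ℕ.<⇒≢ (Linked⇒AllPairs ℕ.<-trans increasing)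

mirror : Tree → Tree
mirror leaf         = leaf
mirror (node l k r) = node (mirror r) k (mirror l)

plug : Ctx → Tree → Tree
plug top         t = t
plug (inL c x r) t = plug c (node t x r)
plug (inR c l x) t = plug c (node l x t)

locate-plug : ∀ k c t {c′ a v b} → locate k c t ≡ just (c′ , a , v , b) →
              plug c′ (node a v b) ≡ plug c t × v ≡ k
locate-plug k c leaf         ()
locate-plug k c (node l x r) found with k ≡ᵇ x in k≡ᵇx
... | true with refl ← found = refl , sym (≡ᵇ-true⇒≡ k≡ᵇx)
... | false with k <ᵇ x
...   | true  = locate-plug k (inL c x r) l found
...   | false = locate-plug k (inR c l x) r found

module _ (T : Tree) where

  wT-nonNeg : ∀ k → 0ℚ ≤ wT T k
  wT-nonNeg k = subst (0ℚ ≤_) (sym (wT≡depthWeight T k)) (depthWeight-nonNeg (depth k T))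

  s-nonNeg : ∀ t → 0ℚ ≤ s T t
  s-nonNeg leaf         = ℚ.≤-refl
  s-nonNeg (node l k r) = +-nonNeg (+-nonNeg (s-nonNeg l) (wT-nonNeg k)) (s-nonNeg r)

  expP-nonNeg : ∀ t → 0ℚ ≤ expP T t
  expP-nonNeg leaf           = 0≤1
  expP-nonNeg t@(node l k r) = *-nonNeg (*-nonNeg (expP-nonNeg l) (s-nonNeg t)) (expP-nonNeg r)

  s-left≤ : ∀ l k r → s T l ≤ s T (node l k r)
  s-left≤ l k r = ℚ.≤-trans (p≤p+q (s T l) (wT-nonNeg k)) (p≤p+q _ (s-nonNeg r))

  s-right≤ : ∀ l k r → s T r ≤ s T (node l k r)
  s-right≤ l k r = q≤p+q (s T r) (+-nonNeg (s-nonNeg l) (wT-nonNeg k))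

  wT≤s : ∀ l k r → wT T k ≤ s T (node l k r)
  wT≤s l k r = ℚ.≤-trans (q≤p+q (wT T k) (s-nonNeg l)) (p≤p+q _ (s-nonNeg r))

  s-pos : ∀ l k r → 0ℚ < wT T k → 0ℚ < s T (node l k r)
  s-pos l k r 0<w = ℚ.<-≤-trans 0<w (wT≤s l k r)

  s-mirror : ∀ t → s T (mirror t) ≡ s T t
  s-mirror leaf         = refl
  s-mirror (node l k r) = begin-equality
    s T (mirror r) ℚ.+ wT T k ℚ.+ s T (mirror l)
      ≡⟨ cong₂ (λ σᵣ σₗ → σᵣ ℚ.+ wT T k ℚ.+ σₗ) (s-mirror r) (s-mirror l) ⟩
    s T r ℚ.+ wT T k ℚ.+ s T l
      ≡⟨ reverse (s T r) (wT T k) (s T l) ⟩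
    s T l ℚ.+ wT T k ℚ.+ s T r ∎
    where
    reverse : ∀ a b c → a ℚ.+ b ℚ.+ c ≡ c ℚ.+ b ℚ.+ a
    reverse = solve-∀ ℚ-ring

  expP-mirror : ∀ t → expP T (mirror t) ≡ expP T t
  expP-mirror leaf           = refl
  expP-mirror t@(node l k r) = begin-equality
    expP T (mirror r) ℚ.* s T (mirror t) ℚ.* expP T (mirror l)
      ≡⟨ cong₂ (λ eᵣ eₗ → eᵣ ℚ.* s T (mirror t) ℚ.* eₗ) (expP-mirror r) (expP-mirror l) ⟩
    expP T r ℚ.* s T (mirror t) ℚ.* expP T l
      ≡⟨ cong (λ σ → expP T r ℚ.* σ ℚ.* expP T l) (s-mirror t) ⟩
    expP T r ℚ.* s T t ℚ.* expP T l
      ≡⟨ reverse (expP T r) (s T t) (expP T l) ⟩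
    expP T l ℚ.* s T t ℚ.* expP T r ∎
    where
    reverse : ∀ a b c → a ℚ.* b ℚ.* c ≡ c ℚ.* b ℚ.* a
    reverse = solve-∀ ℚ-ring

  s-plug-cong : ∀ c X Y → s T X ≡ s T Y → s T (plug c X) ≡ s T (plug c Y)
  s-plug-cong top         X Y eq = eq
  s-plug-cong (inL c x r) X Y eq =
    s-plug-cong c (node X x r) (node Y x r) (cong (λ σ → σ ℚ.+ wT T x ℚ.+ s T r) eq)
  s-plug-cong (inR c l x) X Y eq =
    s-plug-cong c (node l x X) (node l x Y) (cong (λ σ → s T l ℚ.+ wT T x ℚ.+ σ) eq)

  expP-node-monoˡ : ∀ α β X Y x r → s T X ≡ s T Y → α ℚ.* expP T X ≤ β ℚ.* expP T Y →
                    α ℚ.* expP T (node X x r) ≤ β ℚ.* expP T (node Y x r)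
  expP-node-monoˡ α β X Y x r eq h = begin
    α ℚ.* (expP T X ℚ.* s T (node X x r) ℚ.* expP T r)
      ≡⟨ regroup α (expP T X) _ (expP T r) ⟩
    α ℚ.* expP T X ℚ.* (s T (node X x r) ℚ.* expP T r)
      ≤⟨ *-monoʳ-≤ _ (*-nonNeg (s-nonNeg (node X x r)) (expP-nonNeg r)) h ⟩
    β ℚ.* expP T Y ℚ.* (s T (node X x r) ℚ.* expP T r)
      ≡⟨ cong (λ σ → β ℚ.* expP T Y ℚ.* ((σ ℚ.+ wT T x ℚ.+ s T r) ℚ.* expP T r)) eq ⟩
    β ℚ.* expP T Y ℚ.* (s T (node Y x r) ℚ.* expP T r)
      ≡⟨ sym (regroup β (expP T Y) _ (expP T r)) ⟩
    β ℚ.* (expP T Y ℚ.* s T (node Y x r) ℚ.* expP T r) ∎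
    where
    regroup : ∀ a b c d → a ℚ.* (b ℚ.* c ℚ.* d) ≡ a ℚ.* b ℚ.* (c ℚ.* d)
    regroup = solve-∀ ℚ-ring

  expP-node-monoʳ : ∀ α β X Y l x → s T X ≡ s T Y → α ℚ.* expP T X ≤ β ℚ.* expP T Y →
                    α ℚ.* expP T (node l x X) ≤ β ℚ.* expP T (node l x Y)
  expP-node-monoʳ α β X Y l x eq h = begin
    α ℚ.* (expP T l ℚ.* s T (node l x X) ℚ.* expP T X)
      ≡⟨ regroup α (expP T l) _ (expP T X) ⟩
    α ℚ.* expP T X ℚ.* (expP T l ℚ.* s T (node l x X))
      ≤⟨ *-monoʳ-≤ _ (*-nonNeg (expP-nonNeg l) (s-nonNeg (node l x X))) h ⟩
    β ℚ.* expP T Y ℚ.* (expP T l ℚ.* s T (node l x X))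
      ≡⟨ cong (λ σ → β ℚ.* expP T Y ℚ.* (expP T l ℚ.* (s T l ℚ.+ wT T x ℚ.+ σ))) eq ⟩
    β ℚ.* expP T Y ℚ.* (expP T l ℚ.* s T (node l x Y))
      ≡⟨ sym (regroup β (expP T l) _ (expP T Y)) ⟩
    β ℚ.* (expP T l ℚ.* s T (node l x Y) ℚ.* expP T Y) ∎
    where
    regroup : ∀ a b c d → a ℚ.* (b ℚ.* c ℚ.* d) ≡ a ℚ.* d ℚ.* (b ℚ.* c)
    regroup = solve-∀ ℚ-ring

  expP-plug-mono : ∀ c α β X Y → s T X ≡ s T Y → α ℚ.* expP T X ≤ β ℚ.* expP T Y →
                   α ℚ.* expP T (plug c X) ≤ β ℚ.* expP T (plug c Y)
  expP-plug-mono top         α β X Y eq h = h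
  expP-plug-mono (inL c x r) α β X Y eq h =
    expP-plug-mono c α β (node X x r) (node Y x r) (cong (λ σ → σ ℚ.+ wT T x ℚ.+ s T r) eq)
      (expP-node-monoˡ α β X Y x r eq h)
  expP-plug-mono (inR c l x) α β X Y eq h =
    expP-plug-mono c α β (node l x X) (node l x Y) (cong (λ σ → s T l ℚ.+ wT T x ℚ.+ σ) eq)
      (expP-node-monoʳ α β X Y l x eq h)

  -- A splay step replaces the subtree Y by X′, which has the same keys; X is the subtree of the
  -- splayed node before the step.  In logarithmic form the bound reads
  -- log₂ c + P(X′) − P(Y) ≤ 3 (log₂ s(Y) − log₂ s(X)).
  record Step (c : ℚ) (X X′ Y : Tree) : Set where
    field
      s-preserved : s T X′ ≡ s T Y
      bound       : c ℚ.* cube (s T X) ℚ.* expP T X′ ≤ cube (s T Y) ℚ.* expP T Y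

  Step-mirror : ∀ {c X X′ Y} → Step c (mirror X) (mirror X′) (mirror Y) → Step c X X′ Y
  Step-mirror {c} {X} {X′} {Y} step = record
    { s-preserved = trans (sym (s-mirror X′)) (trans (Step.s-preserved step) (s-mirror Y))
    ; bound       = subst₂ _≤_ (cong₂ (λ σ e → c ℚ.* cube σ ℚ.* e) (s-mirror X) (expP-mirror X′))
                               (cong₂ (λ σ e → cube σ ℚ.* e) (s-mirror Y) (expP-mirror Y))
                               (Step.bound step)
    }

  zig-step : ∀ a v b x c → Step 1ℚ (node a v b) (node a v (node b x c)) (node (node a v b) x c)
  zig-step a v b x c = record { s-preserved = s-preserved ; bound = bound }
    where
    Ea Eb Ec σ q R : ℚ
    Ea = expP T a
    Eb = expP T b
    Ec = expP T c
    σ  = s T (node a v b)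
    q  = s T (node b x c)
    R  = s T (node (node a v b) x c)

    s-preserved : s T (node a v (node b x c)) ≡ R
    s-preserved = regroup (s T a) (wT T v) (s T b) (wT T x) (s T c)
      where
      regroup : ∀ A V B X C → A ℚ.+ V ℚ.+ (B ℚ.+ X ℚ.+ C) ≡ A ℚ.+ V ℚ.+ B ℚ.+ X ℚ.+ C
      regroup = solve-∀ ℚ-ring

    0≤σ : 0ℚ ≤ σ
    0≤σ = s-nonNeg (node a v b)

    σ≤R : σ ≤ R
    σ≤R = s-left≤ (node a v b) x c

    q≤R : q ≤ R
    q≤R = ℚ.≤-trans (s-right≤ a v (node b x c)) (ℚ.≤-reflexive s-preserved)

    0≤K : 0ℚ ≤ Ea ℚ.* Eb ℚ.* Ec ℚ.* σ ℚ.* R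
    0≤K = *-nonNeg (*-nonNeg (*-nonNeg (*-nonNeg (expP-nonNeg a) (expP-nonNeg b)) (expP-nonNeg c)) 0≤σ)
                   (s-nonNeg (node (node a v b) x c))

    bound : 1ℚ ℚ.* cube σ ℚ.* expP T (node a v (node b x c)) ≤ cube R ℚ.* expP T (node (node a v b) x c)
    bound = begin
      1ℚ ℚ.* cube σ ℚ.* (Ea ℚ.* s T (node a v (node b x c)) ℚ.* (Eb ℚ.* q ℚ.* Ec))
        ≡⟨ cong (λ ρ → 1ℚ ℚ.* cube σ ℚ.* (Ea ℚ.* ρ ℚ.* (Eb ℚ.* q ℚ.* Ec))) s-preserved ⟩
      1ℚ ℚ.* cube σ ℚ.* (Ea ℚ.* R ℚ.* (Eb ℚ.* q ℚ.* Ec))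
        ≡⟨ regroup₁ Ea Eb Ec σ q R ⟩
      Ea ℚ.* Eb ℚ.* Ec ℚ.* σ ℚ.* R ℚ.* (σ ℚ.* σ ℚ.* q)
        ≤⟨ *-monoˡ-≤ _ 0≤K (*-mono-≤ (*-nonNeg 0≤σ 0≤σ) (s-nonNeg (node b x c))
                                      (*-mono-≤ 0≤σ 0≤σ σ≤R σ≤R) q≤R) ⟩
      Ea ℚ.* Eb ℚ.* Ec ℚ.* σ ℚ.* R ℚ.* (R ℚ.* R ℚ.* R)
        ≡⟨ regroup₂ Ea Eb Ec σ R ⟩
      cube R ℚ.* (Ea ℚ.* σ ℚ.* Eb ℚ.* R ℚ.* Ec) ∎
      where
      regroup₁ : ∀ Ea Eb Ec σ q R → 1ℚ ℚ.* (σ ℚ.* σ ℚ.* σ) ℚ.* (Ea ℚ.* R ℚ.* (Eb ℚ.* q ℚ.* Ec))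
                                    ≡ Ea ℚ.* Eb ℚ.* Ec ℚ.* σ ℚ.* R ℚ.* (σ ℚ.* σ ℚ.* q)
      regroup₁ = solve-∀ ℚ-ring
      regroup₂ : ∀ Ea Eb Ec σ R → Ea ℚ.* Eb ℚ.* Ec ℚ.* σ ℚ.* R ℚ.* (R ℚ.* R ℚ.* R)
                                  ≡ R ℚ.* R ℚ.* R ℚ.* (Ea ℚ.* σ ℚ.* Eb ℚ.* R ℚ.* Ec)
      regroup₂ = solve-∀ ℚ-ring

  zigzig-step : ∀ a v b x c y d →
    Step 4ℚ (node a v b) (node a v (node b x (node c y d))) (node (node (node a v b) x c) y d)
  zigzig-step a v b x c y d = record { s-preserved = s-preserved ; bound = bound }
    where
    Ea Eb Ec Ed σ p q r R : ℚ
    Ea = expP T a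
    Eb = expP T b
    Ec = expP T c
    Ed = expP T d
    σ  = s T (node a v b)
    p  = s T (node (node a v b) x c)
    q  = s T (node b x (node c y d))
    r  = s T (node c y d)
    R  = s T (node (node (node a v b) x c) y d)

    s-preserved : s T (node a v (node b x (node c y d))) ≡ R
    s-preserved = regroup (s T a) (wT T v) (s T b) (wT T x) (s T c) (wT T y) (s T d)
      where
      regroup : ∀ A V B X C Y D → A ℚ.+ V ℚ.+ (B ℚ.+ X ℚ.+ (C ℚ.+ Y ℚ.+ D))
                                ≡ A ℚ.+ V ℚ.+ B ℚ.+ X ℚ.+ C ℚ.+ Y ℚ.+ D
      regroup = solve-∀ ℚ-ring

    σ+r≤R : σ ℚ.+ r ≤ R
    σ+r≤R = subst (σ ℚ.+ r ≤_) (sym (regroup σ (wT T x) (s T c) (wT T y) (s T d)))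
                  (p≤p+q (σ ℚ.+ r) (wT-nonNeg x))
      where
      regroup : ∀ σ X C Y D → σ ℚ.+ X ℚ.+ C ℚ.+ Y ℚ.+ D ≡ σ ℚ.+ (C ℚ.+ Y ℚ.+ D) ℚ.+ X
      regroup = solve-∀ ℚ-ring

    0≤σ : 0ℚ ≤ σ
    0≤σ = s-nonNeg (node a v b)

    0≤K : 0ℚ ≤ Ea ℚ.* Eb ℚ.* Ec ℚ.* Ed ℚ.* σ ℚ.* R
    0≤K = *-nonNeg (*-nonNeg (*-nonNeg (*-nonNeg (*-nonNeg (expP-nonNeg a) (expP-nonNeg b)) (expP-nonNeg c))
                                        (expP-nonNeg d)) 0≤σ)
                   (s-nonNeg (node (node (node a v b) x c) y d))

    bound : 4ℚ ℚ.* cube σ ℚ.* expP T (node a v (node b x (node c y d)))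
            ≤ cube R ℚ.* expP T (node (node (node a v b) x c) y d)
    bound = begin
      4ℚ ℚ.* cube σ ℚ.* (Ea ℚ.* s T (node a v (node b x (node c y d))) ℚ.* (Eb ℚ.* q ℚ.* (Ec ℚ.* r ℚ.* Ed)))
        ≡⟨ cong (λ ρ → 4ℚ ℚ.* cube σ ℚ.* (Ea ℚ.* ρ ℚ.* (Eb ℚ.* q ℚ.* (Ec ℚ.* r ℚ.* Ed)))) s-preserved ⟩
      4ℚ ℚ.* cube σ ℚ.* (Ea ℚ.* R ℚ.* (Eb ℚ.* q ℚ.* (Ec ℚ.* r ℚ.* Ed)))
        ≡⟨ regroup₁ Ea Eb Ec Ed σ q r R ⟩
      Ea ℚ.* Eb ℚ.* Ec ℚ.* Ed ℚ.* σ ℚ.* R ℚ.* (σ ℚ.* q ℚ.* (4ℚ ℚ.* (σ ℚ.* r)))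
        ≤⟨ *-monoˡ-≤ _ 0≤K (double-rotation-bound 0≤σ (s-nonNeg (node b x (node c y d))) 0≤σ (s-nonNeg (node c y d))
                              (s-left≤ (node a v b) x c)
                              (ℚ.≤-trans (s-right≤ a v (node b x (node c y d))) (ℚ.≤-reflexive s-preserved))
                              σ+r≤R) ⟩
      Ea ℚ.* Eb ℚ.* Ec ℚ.* Ed ℚ.* σ ℚ.* R ℚ.* (p ℚ.* R ℚ.* (R ℚ.* R))
        ≡⟨ regroup₂ Ea Eb Ec Ed σ p R ⟩
      cube R ℚ.* (Ea ℚ.* σ ℚ.* Eb ℚ.* p ℚ.* Ec ℚ.* R ℚ.* Ed) ∎
      where
      regroup₁ : ∀ Ea Eb Ec Ed σ q r R →
        4ℚ ℚ.* (σ ℚ.* σ ℚ.* σ) ℚ.* (Ea ℚ.* R ℚ.* (Eb ℚ.* q ℚ.* (Ec ℚ.* r ℚ.* Ed)))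
          ≡ Ea ℚ.* Eb ℚ.* Ec ℚ.* Ed ℚ.* σ ℚ.* R ℚ.* (σ ℚ.* q ℚ.* (4ℚ ℚ.* (σ ℚ.* r)))
      regroup₁ = solve-∀ ℚ-ring
      regroup₂ : ∀ Ea Eb Ec Ed σ p R →
        Ea ℚ.* Eb ℚ.* Ec ℚ.* Ed ℚ.* σ ℚ.* R ℚ.* (p ℚ.* R ℚ.* (R ℚ.* R))
          ≡ R ℚ.* R ℚ.* R ℚ.* (Ea ℚ.* σ ℚ.* Eb ℚ.* p ℚ.* Ec ℚ.* R ℚ.* Ed)
      regroup₂ = solve-∀ ℚ-ring

  zigzag-step : ∀ a v b x c y d →
    Step 4ℚ (node a v b) (node (node d y a) v (node b x c)) (node d y (node (node a v b) x c))
  zigzag-step a v b x c y d = record { s-preserved = s-preserved ; bound = bound }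
    where
    Ea Eb Ec Ed σ p q₁ q₂ R : ℚ
    Ea = expP T a
    Eb = expP T b
    Ec = expP T c
    Ed = expP T d
    σ  = s T (node a v b)
    p  = s T (node (node a v b) x c)
    q₁ = s T (node d y a)
    q₂ = s T (node b x c)
    R  = s T (node d y (node (node a v b) x c))

    s-preserved : s T (node (node d y a) v (node b x c)) ≡ R
    s-preserved = regroup (s T a) (wT T v) (s T b) (wT T x) (s T c) (wT T y) (s T d)
      where
      regroup : ∀ A V B X C Y D → D ℚ.+ Y ℚ.+ A ℚ.+ V ℚ.+ (B ℚ.+ X ℚ.+ C)
                                ≡ D ℚ.+ Y ℚ.+ (A ℚ.+ V ℚ.+ B ℚ.+ X ℚ.+ C)
      regroup = solve-∀ ℚ-ring

    q₁+q₂≤R : q₁ ℚ.+ q₂ ≤ R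
    q₁+q₂≤R = subst (q₁ ℚ.+ q₂ ≤_) (sym (regroup (s T a) (wT T v) (s T b) (wT T x) (s T c) (wT T y) (s T d)))
                    (p≤p+q (q₁ ℚ.+ q₂) (wT-nonNeg v))
      where
      regroup : ∀ A V B X C Y D → D ℚ.+ Y ℚ.+ (A ℚ.+ V ℚ.+ B ℚ.+ X ℚ.+ C)
                                ≡ D ℚ.+ Y ℚ.+ A ℚ.+ (B ℚ.+ X ℚ.+ C) ℚ.+ V
      regroup = solve-∀ ℚ-ring

    0≤σ : 0ℚ ≤ σ
    0≤σ = s-nonNeg (node a v b)

    σ≤p : σ ≤ p
    σ≤p = s-left≤ (node a v b) x c

    0≤K : 0ℚ ≤ Ea ℚ.* Eb ℚ.* Ec ℚ.* Ed ℚ.* σ ℚ.* R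
    0≤K = *-nonNeg (*-nonNeg (*-nonNeg (*-nonNeg (*-nonNeg (expP-nonNeg a) (expP-nonNeg b)) (expP-nonNeg c))
                                        (expP-nonNeg d)) 0≤σ)
                   (s-nonNeg (node d y (node (node a v b) x c)))

    bound : 4ℚ ℚ.* cube σ ℚ.* expP T (node (node d y a) v (node b x c))
            ≤ cube R ℚ.* expP T (node d y (node (node a v b) x c))
    bound = begin
      4ℚ ℚ.* cube σ ℚ.* (Ed ℚ.* q₁ ℚ.* Ea ℚ.* s T (node (node d y a) v (node b x c)) ℚ.* (Eb ℚ.* q₂ ℚ.* Ec))
        ≡⟨ cong (λ ρ → 4ℚ ℚ.* cube σ ℚ.* (Ed ℚ.* q₁ ℚ.* Ea ℚ.* ρ ℚ.* (Eb ℚ.* q₂ ℚ.* Ec))) s-preserved ⟩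
      4ℚ ℚ.* cube σ ℚ.* (Ed ℚ.* q₁ ℚ.* Ea ℚ.* R ℚ.* (Eb ℚ.* q₂ ℚ.* Ec))
        ≡⟨ regroup₁ Ea Eb Ec Ed σ q₁ q₂ R ⟩
      Ea ℚ.* Eb ℚ.* Ec ℚ.* Ed ℚ.* σ ℚ.* R ℚ.* (σ ℚ.* σ ℚ.* (4ℚ ℚ.* (q₁ ℚ.* q₂)))
        ≤⟨ *-monoˡ-≤ _ 0≤K (double-rotation-bound 0≤σ 0≤σ (s-nonNeg (node d y a)) (s-nonNeg (node b x c))
                              σ≤p (ℚ.≤-trans σ≤p (s-right≤ d y (node (node a v b) x c))) q₁+q₂≤R) ⟩
      Ea ℚ.* Eb ℚ.* Ec ℚ.* Ed ℚ.* σ ℚ.* R ℚ.* (p ℚ.* R ℚ.* (R ℚ.* R))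
        ≡⟨ regroup₂ Ea Eb Ec Ed σ p R ⟩
      cube R ℚ.* (Ed ℚ.* R ℚ.* (Ea ℚ.* σ ℚ.* Eb ℚ.* p ℚ.* Ec)) ∎
      where
      regroup₁ : ∀ Ea Eb Ec Ed σ q₁ q₂ R →
        4ℚ ℚ.* (σ ℚ.* σ ℚ.* σ) ℚ.* (Ed ℚ.* q₁ ℚ.* Ea ℚ.* R ℚ.* (Eb ℚ.* q₂ ℚ.* Ec))
          ≡ Ea ℚ.* Eb ℚ.* Ec ℚ.* Ed ℚ.* σ ℚ.* R ℚ.* (σ ℚ.* σ ℚ.* (4ℚ ℚ.* (q₁ ℚ.* q₂)))
      regroup₁ = solve-∀ ℚ-ring
      regroup₂ : ∀ Ea Eb Ec Ed σ p R →
        Ea ℚ.* Eb ℚ.* Ec ℚ.* Ed ℚ.* σ ℚ.* R ℚ.* (p ℚ.* R ℚ.* (R ℚ.* R))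
          ≡ R ℚ.* R ℚ.* R ℚ.* (Ed ℚ.* R ℚ.* (Ea ℚ.* σ ℚ.* Eb ℚ.* p ℚ.* Ec))
      regroup₂ = solve-∀ ℚ-ring

  -- In logarithmic form: n + P(S′) − P(S) ≤ 1 + 3 (log₂ s(S) − log₂ s(X)), where X is the subtree of S
  -- rooted at the splayed node and splaying it produces S′ at cost n.
  AccessBound : Tree → Tree → Tree × ℕ → Set
  AccessBound X S (S′ , n) = pow2 n ℚ.* expP T S′ ℚ.* cube (s T X) ≤ 2ℚ ℚ.* cube (s T S) ℚ.* expP T S

  root-access : ∀ X → AccessBound X X (X , 0)
  root-access X = begin
    1ℚ ℚ.* expP T X ℚ.* cube (s T X)
      ≡⟨ swap (expP T X) (s T X) ⟩
    1ℚ ℚ.* cube (s T X) ℚ.* expP T X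
      ≤⟨ *-monoʳ-≤ _ (expP-nonNeg X) (*-monoʳ-≤ _ (cube-nonNeg (s-nonNeg X)) 1≤2) ⟩
    2ℚ ℚ.* cube (s T X) ℚ.* expP T X ∎
    where
    swap : ∀ e σ → 1ℚ ℚ.* e ℚ.* (σ ℚ.* σ ℚ.* σ) ≡ 1ℚ ℚ.* (σ ℚ.* σ ℚ.* σ) ℚ.* e
    swap = solve-∀ ℚ-ring

  zig-access : ∀ {X X′ Y} → Step 1ℚ X X′ Y → AccessBound X Y (X′ , 1)
  zig-access {X} {X′} {Y} step = begin
    2ℚ ℚ.* expP T X′ ℚ.* cube (s T X)
      ≡⟨ regroup (expP T X′) (s T X) ⟩
    2ℚ ℚ.* (1ℚ ℚ.* cube (s T X) ℚ.* expP T X′)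
      ≤⟨ *-monoˡ-≤ 2ℚ (ℚ.nonNegative⁻¹ 2ℚ) (Step.bound step) ⟩
    2ℚ ℚ.* (cube (s T Y) ℚ.* expP T Y)
      ≡⟨ sym (ℚ.*-assoc 2ℚ (cube (s T Y)) (expP T Y)) ⟩
    2ℚ ℚ.* cube (s T Y) ℚ.* expP T Y ∎
    where
    regroup : ∀ e σ → 2ℚ ℚ.* e ℚ.* (σ ℚ.* σ ℚ.* σ) ≡ 2ℚ ℚ.* (1ℚ ℚ.* (σ ℚ.* σ ℚ.* σ) ℚ.* e)
    regroup = solve-∀ ℚ-ring

  -- Chaining the bound for the rest of the splay (from X′) with the step bound lifted through the
  -- context c proves the goal multiplied by cube (s X′), which is then cancelled.
  double-step-access : ∀ c {X a′ v b′ Y} → Step 4ℚ X (node a′ v b′) Y → 0ℚ < wT T v →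
                       AccessBound (node a′ v b′) (plug c (node a′ v b′)) (splayUp c a′ v b′) →
                       let (S′ , n) = splayUp c a′ v b′ in AccessBound X (plug c Y) (S′ , 2 + n)
  double-step-access c {X} {a′} {v} {b′} {Y} step 0<w ih =
    ℚ.*-cancelˡ-≤-pos (cube σ′) {{ℚ.positive (cube-pos (s-pos a′ v b′ 0<w))}} (begin
      cube σ′ ℚ.* (pow2 (2 + n) ℚ.* expP T S′ ℚ.* cube σ)
        ≡⟨ cong (λ z → cube σ′ ℚ.* (z ℚ.* expP T S′ ℚ.* cube σ)) (pow2-+ 2 n) ⟩
      cube σ′ ℚ.* (4ℚ ℚ.* pow2 n ℚ.* expP T S′ ℚ.* cube σ)
        ≡⟨ regroup₁ σ′ (pow2 n) (expP T S′) σ ⟩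
      pow2 n ℚ.* expP T S′ ℚ.* cube σ′ ℚ.* (4ℚ ℚ.* cube σ)
        ≤⟨ *-monoʳ-≤ _ (*-nonNeg (ℚ.nonNegative⁻¹ 4ℚ) (cube-nonNeg (s-nonNeg X))) ih′ ⟩
      2ℚ ℚ.* cube R ℚ.* expP T (plug c X′) ℚ.* (4ℚ ℚ.* cube σ)
        ≡⟨ regroup₂ R (expP T (plug c X′)) σ ⟩
      2ℚ ℚ.* cube R ℚ.* (4ℚ ℚ.* cube σ ℚ.* expP T (plug c X′))
        ≤⟨ *-monoˡ-≤ _ (*-nonNeg (ℚ.nonNegative⁻¹ 2ℚ) (cube-nonNeg (s-nonNeg (plug c Y)))) lifted ⟩
      2ℚ ℚ.* cube R ℚ.* (cube σ′ ℚ.* expP T (plug c Y))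
        ≡⟨ regroup₃ R σ′ (expP T (plug c Y)) ⟩
      cube σ′ ℚ.* (2ℚ ℚ.* cube R ℚ.* expP T (plug c Y)) ∎)
    where
    X′ S′ : Tree
    X′ = node a′ v b′
    S′ = proj₁ (splayUp c a′ v b′)
    n : ℕ
    n = proj₂ (splayUp c a′ v b′)
    σ σ′ R : ℚ
    σ  = s T X
    σ′ = s T X′
    R  = s T (plug c Y)

    ih′ : pow2 n ℚ.* expP T S′ ℚ.* cube σ′ ≤ 2ℚ ℚ.* cube R ℚ.* expP T (plug c X′)
    ih′ = subst (λ ρ → pow2 n ℚ.* expP T S′ ℚ.* cube σ′ ≤ 2ℚ ℚ.* cube ρ ℚ.* expP T (plug c X′))
                (s-plug-cong c X′ Y (Step.s-preserved step)) ih

    lifted : 4ℚ ℚ.* cube σ ℚ.* expP T (plug c X′) ≤ cube σ′ ℚ.* expP T (plug c Y)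
    lifted = subst (λ ρ → 4ℚ ℚ.* cube σ ℚ.* expP T (plug c X′) ≤ cube ρ ℚ.* expP T (plug c Y))
                   (sym (Step.s-preserved step))
                   (expP-plug-mono c (4ℚ ℚ.* cube σ) (cube (s T Y)) X′ Y (Step.s-preserved step) (Step.bound step))

    regroup₁ : ∀ σ′ P e σ → (σ′ ℚ.* σ′ ℚ.* σ′) ℚ.* (4ℚ ℚ.* P ℚ.* e ℚ.* (σ ℚ.* σ ℚ.* σ))
                            ≡ P ℚ.* e ℚ.* (σ′ ℚ.* σ′ ℚ.* σ′) ℚ.* (4ℚ ℚ.* (σ ℚ.* σ ℚ.* σ))
    regroup₁ = solve-∀ ℚ-ring
    regroup₂ : ∀ R e σ → 2ℚ ℚ.* (R ℚ.* R ℚ.* R) ℚ.* e ℚ.* (4ℚ ℚ.* (σ ℚ.* σ ℚ.* σ))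
                         ≡ 2ℚ ℚ.* (R ℚ.* R ℚ.* R) ℚ.* (4ℚ ℚ.* (σ ℚ.* σ ℚ.* σ) ℚ.* e)
    regroup₂ = solve-∀ ℚ-ring
    regroup₃ : ∀ R σ′ e → 2ℚ ℚ.* (R ℚ.* R ℚ.* R) ℚ.* ((σ′ ℚ.* σ′ ℚ.* σ′) ℚ.* e)
                          ≡ (σ′ ℚ.* σ′ ℚ.* σ′) ℚ.* (2ℚ ℚ.* (R ℚ.* R ℚ.* R) ℚ.* e)
    regroup₃ = solve-∀ ℚ-ring

  splayUp-access : ∀ c a v b → 0ℚ < wT T v → AccessBound (node a v b) (plug c (node a v b)) (splayUp c a v b)
  splayUp-access top                   a v b _   = root-access (node a v b)
  splayUp-access (inL top x c)         a v b _   = zig-access (zig-step a v b x c)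
  splayUp-access (inR top c x)         a v b _   =
    zig-access (Step-mirror (zig-step (mirror b) v (mirror a) x (mirror c)))
  splayUp-access (inL (inL g y d) x c) a v b 0<w =
    double-step-access g (zigzig-step a v b x c y d) 0<w (splayUp-access g a v (node b x (node c y d)) 0<w)
  splayUp-access (inR (inR g d y) c x) a v b 0<w =
    double-step-access g (Step-mirror (zigzig-step (mirror b) v (mirror a) x (mirror c) y (mirror d))) 0<w
      (splayUp-access g (node (node d y c) x a) v b 0<w)
  splayUp-access (inL (inR g d y) x c) a v b 0<w =
    double-step-access g (zigzag-step a v b x c y d) 0<w (splayUp-access g (node d y a) v (node b x c) 0<w)
  splayUp-access (inR (inL g y d) c x) a v b 0<w =
    double-step-access g (Step-mirror (zigzag-step (mirror b) v (mirror a) x (mirror c) y (mirror d))) 0<w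
      (splayUp-access g (node c x a) v (node b y d) 0<w)

  splay-access : ∀ k S {S′ cost} → 0ℚ < wT T k → splay k S ≡ just (S′ , cost) →
                 ∃[ a ] ∃[ b ] AccessBound (node a k b) S (S′ , cost)
  splay-access k S 0<w splayed with locate k top S in found
  ... | nothing with () ← splayed
  ... | just (c , a , v , b) with locate-plug k top S found | just-injective splayed
  ... | refl , refl | refl = a , b , splayUp-access c a v b 0<w

  amortized-bound : ∀ d X S S′ n → ¼^ d ≤ s T X → s T S ≤ 2ℚ → AccessBound X S (S′ , n) →
                    pow2 n ℚ.* expP T S′ ≤ pow2 (4 + 6 * d) ℚ.* expP T S
  amortized-bound d X S S′ n ¼^d≤σ R≤2 access = begin
    A
      ≡⟨ sym (ℚ.*-identityʳ A) ⟩
    A ℚ.* cube 1ℚ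
      ≡⟨ cong (λ z → A ℚ.* cube z) (sym (¼^-inverse d)) ⟩
    A ℚ.* cube (¼^ d ℚ.* Q)
      ≤⟨ *-monoˡ-≤ A 0≤A (cube-mono-≤ (*-nonNeg (ℚ.<⇒≤ (¼^-pos d)) 0≤Q) (*-monoʳ-≤ Q 0≤Q ¼^d≤σ)) ⟩
    A ℚ.* cube (σ ℚ.* Q)
      ≡⟨ regroup₁ A σ Q ⟩
    A ℚ.* cube σ ℚ.* cube Q
      ≤⟨ *-monoʳ-≤ (cube Q) (cube-nonNeg 0≤Q) access ⟩
    2ℚ ℚ.* cube R ℚ.* expP T S ℚ.* cube Q
      ≤⟨ *-monoʳ-≤ (cube Q) (cube-nonNeg 0≤Q)
           (*-monoʳ-≤ (expP T S) (expP-nonNeg S)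
             (*-monoˡ-≤ 2ℚ (ℚ.nonNegative⁻¹ 2ℚ) (cube-mono-≤ (s-nonNeg S) R≤2))) ⟩
    2ℚ ℚ.* cube 2ℚ ℚ.* expP T S ℚ.* cube Q
      ≡⟨ regroup₂ (expP T S) Q ⟩
    2ℚ ℚ.* cube 2ℚ ℚ.* cube Q ℚ.* expP T S
      ≡⟨ cong (ℚ._* expP T S) (sym (pow2-4+6* d)) ⟩
    pow2 (4 + 6 * d) ℚ.* expP T S ∎
    where
    A σ R Q : ℚ
    A = pow2 n ℚ.* expP T S′
    σ = s T X
    R = s T S
    Q = pow2 (d + d)

    0≤A : 0ℚ ≤ A
    0≤A = *-nonNeg (pow2-nonNeg n) (expP-nonNeg S′)

    0≤Q : 0ℚ ≤ Q
    0≤Q = pow2-nonNeg (d + d)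

    regroup₁ : ∀ A σ Q → A ℚ.* ((σ ℚ.* Q) ℚ.* (σ ℚ.* Q) ℚ.* (σ ℚ.* Q))
                       ≡ A ℚ.* (σ ℚ.* σ ℚ.* σ) ℚ.* (Q ℚ.* Q ℚ.* Q)
    regroup₁ = solve-∀ ℚ-ring
    regroup₂ : ∀ e Q → 2ℚ ℚ.* cube 2ℚ ℚ.* e ℚ.* (Q ℚ.* Q ℚ.* Q) ≡ 2ℚ ℚ.* cube 2ℚ ℚ.* (Q ℚ.* Q ℚ.* Q) ℚ.* e
    regroup₂ = solve-∀ ℚ-ring

lemma4p4 : (T S : Tree) → IsBST T → IsBST S → SameKeys S T →
    (k d : ℕ) → depth k T ≡ just d →
    (S′ : Tree) (cost : ℕ) → splay k S ≡ just (S′ , cost) →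
    pow2 cost ℚ.* expP T S′ ≤ pow2 (4 + 6 * d) ℚ.* expP T S
lemma4p4 T S _ S-bst _ k d k-depth S′ cost splayed =
  let a , b , access = splay-access T k S (subst (0ℚ <_) (sym w≡¼^d) (¼^-pos d)) splayed
  in amortized-bound T d (node a k b) S S′ cost
       (subst (_≤ s T (node a k b)) w≡¼^d (wT≤s T a k b)) (s≤2 T S S-bst) access
  where
  w≡¼^d : wT T k ≡ ¼^ d
  w≡¼^d = trans (wT≡depthWeight T k) (cong depthWeight k-depth)
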